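{- Let $n,\alpha$ be integers with $1\le\alpha\le n$. Then \[f_{\sf T}(n,\alpha)=\begin{cases} n+1 & \text{if } \alpha=1,\\ 2^n & \text{if } \alpha=n,\\ f_{\sf T}(n-1,\alpha)+f_{\sf T}\!\left(n-\lceil n/\alpha\rceil,\alpha-1\right) & \text{if } 2\le\alpha\le n-1.\end{cases}\]
   Context: The Fibonacci index $F(G)$ of a graph is the number of its stable sets (sets of pairwise non-adjacent vertices), including the empty set. For $1\le\alpha\le n$, the Turán graph $T_{n,\alpha}$ is the disjoint union of $\alpha$ cliques with orders summing to $n$ and pairwise differing by at most one, and $f_{\sf T}(n,\alpha)=F(T_{n,\alpha})$. -}

module Defs where

open import Data.Nat using (ℕ; zero; suc; _+_; _∸_; _%_; _/_)
open import Data.Bool using (Bool; true; false)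
open import Data.Fin using (Fin; toℕ)
open import Data.Fin.Properties using (all?)
open import Data.Fin.Subset using (Subset; _∈_)
open import Data.Fin.Subset.Properties using (_∈?_)
open import Data.Vec using ([]; _∷_)
open import Data.List using (List; []; _∷_; map; _++_; filter; length)
open import Data.Product using (_×_)
open import Relation.Nullary using (¬_; Dec)
open import Relation.Nullary.Decidable using (_×-dec_; ¬?; _→-dec_)
open import Relation.Binary.PropositionalEquality using (_≡_; _≢_)
import Data.Nat.Properties as ℕP
import Data.Fin.Properties as FinP

record Graph (n : ℕ) : Set₁ where
  field
    Adj   : Fin n → Fin n → Set
    adj?  : ∀ i j → Dec (Adj i j)
    sym   : ∀ {i j} → Adj i j → Adj j i
    irrefl : ∀ {i} → ¬ Adj i i
open Graph public

Stable : ∀ {n} → Graph n → Subset n → Set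
Stable G S = ∀ i j → i ∈ S → j ∈ S → ¬ Adj G i j

stable? : ∀ {n} (G : Graph n) (S : Subset n) → Dec (Stable G S)
stable? G S = all? λ i → all? λ j → (i ∈? S) →-dec ((j ∈? S) →-dec ¬? (adj? G i j))

allSubsets : (n : ℕ) → List (Subset n)
allSubsets zero = [] ∷ []
allSubsets (suc n) = map (false ∷_) (allSubsets n) ++ map (true ∷_) (allSubsets n)

-- Fibonacci index: number of stable sets (including the empty set).
F : ∀ {n} → Graph n → ℕ
F {n} G = length (filter (stable? G) (allSubsets n))

-- Turán graph T_{n,α} for α ≥ 1 (α = suc k): vertex i lies in clique (i mod α);
-- the α cliques have orders summing to n and pairwise differing by at most one.
Turán : (n k : ℕ) → Graph n
Turán n k = record
  { Adj = λ i j → (i ≢ j) × (toℕ i % suc k ≡ toℕ j % suc k)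
  ; adj? = λ i j → ¬? (i FinP.≟ j) ×-dec (toℕ i % suc k ℕP.≟ toℕ j % suc k)
  ; sym = λ { (p , q) → (λ e → p (symm e)) , symm q }
  ; irrefl = λ { (p , _) → p reflx }
  }
  where
    open import Relation.Binary.PropositionalEquality renaming (sym to symm; refl to reflx)
    open import Data.Product using (_,_)

-- f_T(n, α) = F(T_{n,α}); the value at α = 0 is a junk value (T_{n,0} is undefined).
fT : ℕ → ℕ → ℕ
fT n zero = 0
fT n (suc k) = F (Turán n k)

-- ⌈ n / α ⌉ for α ≥ 1 (junk 0 at α = 0).
ceilDiv : ℕ → ℕ → ℕ
ceilDiv n zero = 0
ceilDiv n (suc k) = (n + k) / suc k

module Submission where

-- Strategy: compute f_T(n, α) in closed form and read off the three cases.
-- T_{n,α} colours vertex i by i mod α and joins distinct vertices of equal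
-- colour, so its stable sets are the "rainbow" sets (pairwise distinct colours).
-- 1. Rainbow sets of a colour list are counted by a skip/take recursion
--    (rainbow); a free colour occurring o times contributes a factor o + 1
--    (rainbow-factor), so appending one more vertex of that colour multiplies
--    the count by (o + 2)/(o + 1) (rainbow-append-free).
-- 2. For any graph given by a colouring, F counts its rainbow subsets
--    (F-colour-classes), via a Boolean rainbow test on subsets.
-- 3. Walking through n = ρ + qα vertex by vertex (block-induction) and tracking
--    the colour counts gives F(T_{ρ+qα,α}) = (q+2)^ρ (q+1)^(α−ρ) for 0 ≤ ρ ≤ α
--    (fT-closed).
-- 4. The cases α = 1 and α = n are instances of the closed form; writing
--    n = (ρ + 1) + qα, the recurrence becomes the identity Φ-recurrence,
--    since n − 1 = ρ + qα and n − ⌈n/α⌉ = ρ + q(α − 1).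

open import Defs hiding (sym)
open import Data.Nat using (ℕ; zero; suc; _+_; _*_; _∸_; _^_; _≤_; _<_; z≤n; s≤s; NonZero; _%_; _/_; _≡ᵇ_)
open import Data.Nat.Properties
open import Data.Nat.DivMod using ([m+kn]%n≡m%n; m<n⇒m%n≡m; m%n<n; m≡m%n+[m/n]*n; +-distrib-/-∣ʳ; m<n⇒m/n≡0; m*n/n≡m)
open import Data.Nat.Divisibility using (n∣m*n)
open import Data.Nat.Solver using (module +-*-Solver)
open import Data.Bool using (Bool; true; false; T; _∨_; if_then_else_)
open import Data.Bool.Properties using (∨-assoc; ∨-comm; ∨-zeroʳ; ∨-conicalˡ; ∨-conicalʳ)
open import Data.List using (List; []; _∷_; _++_; [_]; map; filter; length; tabulate; applyUpTo)
open import Data.List.Properties using (filter-++; length-++; filter-accept; filter-reject; applyUpTo-∷ʳ)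
open import Data.Product using (_×_; _,_; proj₁; proj₂)
open import Data.Sum using (inj₁; inj₂)
open import Data.Fin using (Fin; zero; suc; toℕ)
import Data.Fin.Properties as Fin
open import Data.Fin.Subset using (Subset; _∈_)
open import Data.Vec using ([]; _∷_; here; there)
open import Function using (_∘_; id; _⇔_; mk⇔; Equivalence)
open Equivalence using (to; from)
open import Algebra.Properties.CommutativeSemigroup *-commutativeSemigroup using (x∙yz≈y∙xz)
open import Relation.Unary using (Decidable)
open import Relation.Nullary using (contradiction; yes; no)
open import Relation.Binary.PropositionalEquality hiding ([_])

≡ᵇ-true⇒≡ : ∀ m n → (m ≡ᵇ n) ≡ true → m ≡ n
≡ᵇ-true⇒≡ m n e = ≡ᵇ⇒≡ m n (subst T (sym e) _)

≢⇒≡ᵇ-false : ∀ {m n} → m ≢ n → (m ≡ᵇ n) ≡ false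
≢⇒≡ᵇ-false {m} {n} m≢n with m ≡ᵇ n in e
... | true  = contradiction (≡ᵇ-true⇒≡ m n e) m≢n
... | false = refl

≡ᵇ-refl : ∀ n → (n ≡ᵇ n) ≡ true
≡ᵇ-refl zero    = refl
≡ᵇ-refl (suc n) = ≡ᵇ-refl n

≡ᵇ-false⇒≢ : ∀ m n → (m ≡ᵇ n) ≡ false → m ≢ n
≡ᵇ-false⇒≢ m .m e refl with () ← trans (sym (≡ᵇ-refl m)) e

-- A palette is the set of colours already in use, as a Boolean predicate;
-- X ⊕ d adds the colour d to it.
Palette : Set
Palette = ℕ → Bool

∅ : Palette
∅ _ = false

_⊕_ : Palette → ℕ → Palette
(X ⊕ d) x = X x ∨ (x ≡ᵇ d)

-- rainbow X cs: the number of sets of positions in the colour list cs whose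
-- colours are pairwise distinct and not in X (each position is skipped or,
-- if its colour is still free, taken).
rainbow : Palette → List ℕ → ℕ
rainbow X []       = 1
rainbow X (d ∷ ds) = if X d then rainbow X ds else rainbow X ds + rainbow (X ⊕ d) ds

occ : ℕ → List ℕ → ℕ
occ c cs = length (filter (_≟ c) cs)

rainbow-cong : ∀ {X Y} → (∀ x → X x ≡ Y x) → ∀ cs → rainbow X cs ≡ rainbow Y cs
rainbow-cong X≗Y []       = refl
rainbow-cong {X} {Y} X≗Y (d ∷ ds) rewrite X≗Y d =
  cong₂ (λ a b → if Y d then a else a + b)
        (rainbow-cong X≗Y ds) (rainbow-cong (λ x → cong (_∨ _) (X≗Y x)) ds)

⊕-comm : ∀ X c d x → ((X ⊕ c) ⊕ d) x ≡ ((X ⊕ d) ⊕ c) x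
⊕-comm X c d x = begin
  (X x ∨ (x ≡ᵇ c)) ∨ (x ≡ᵇ d) ≡⟨ ∨-assoc (X x) _ _ ⟩
  X x ∨ ((x ≡ᵇ c) ∨ (x ≡ᵇ d)) ≡⟨ cong (X x ∨_) (∨-comm (x ≡ᵇ c) _) ⟩
  X x ∨ ((x ≡ᵇ d) ∨ (x ≡ᵇ c)) ≡⟨ ∨-assoc (X x) _ _ ⟨
  (X x ∨ (x ≡ᵇ d)) ∨ (x ≡ᵇ c) ∎
  where open ≡-Reasoning

-- The colour class of a free colour c contributes an independent factor: a
-- rainbow selection takes none or exactly one of the occ c cs positions of colour c.
rainbow-factor : ∀ X c → X c ≡ false → ∀ cs →
                 rainbow X cs ≡ suc (occ c cs) * rainbow (X ⊕ c) cs
rainbow-factor X c Xc [] = refl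
rainbow-factor X c Xc (d ∷ ds) with X d in Xd | d ≡ᵇ c in d≡ᵇc
... | true  | true  with refl ← ≡ᵇ-true⇒≡ d c d≡ᵇc with () ← trans (sym Xd) Xc
... | true  | false = rainbow-factor X c Xc ds
... | false | true  with refl ← ≡ᵇ-true⇒≡ d c d≡ᵇc =
  trans (cong (_+ rainbow (X ⊕ c) ds) (rainbow-factor X c Xc ds))
        (+-comm (suc (occ c ds) * rainbow (X ⊕ c) ds) _)
... | false | false = begin
  rainbow X ds + rainbow (X ⊕ d) ds
    ≡⟨ cong₂ _+_ (rainbow-factor X c Xc ds) (rainbow-factor (X ⊕ d) c Xdc ds) ⟩
  m * rainbow (X ⊕ c) ds + m * rainbow ((X ⊕ d) ⊕ c) ds
    ≡⟨ cong (λ r → m * rainbow (X ⊕ c) ds + m * r) (rainbow-cong (⊕-comm X d c) ds) ⟩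
  m * rainbow (X ⊕ c) ds + m * rainbow ((X ⊕ c) ⊕ d) ds
    ≡⟨ *-distribˡ-+ m (rainbow (X ⊕ c) ds) _ ⟨
  m * (rainbow (X ⊕ c) ds + rainbow ((X ⊕ c) ⊕ d) ds) ∎
  where
    open ≡-Reasoning
    m = suc (occ c ds)
    Xdc : (X ⊕ d) c ≡ false
    Xdc rewrite Xc = ≢⇒≡ᵇ-false (≢-sym (≡ᵇ-false⇒≢ d c d≡ᵇc))

rainbow-append-used : ∀ X d → X d ≡ true → ∀ cs → rainbow X (cs ++ [ d ]) ≡ rainbow X cs
rainbow-append-used X d Xd []       rewrite Xd = refl
rainbow-append-used X d Xd (e ∷ es) =
  cong₂ (λ a b → if X e then a else a + b)
        (rainbow-append-used X d Xd es) (rainbow-append-used (X ⊕ e) d (cong (_∨ (d ≡ᵇ e)) Xd) es)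

occ-snoc : ∀ c d cs → occ c (cs ++ [ d ]) ≡ occ c cs + occ c [ d ]
occ-snoc c d cs = trans (cong length (filter-++ (_≟ c) cs [ d ])) (length-++ (filter (_≟ c) cs))

occ-self : ∀ c → occ c [ c ] ≡ 1
occ-self c = cong length (filter-accept (_≟ c) refl)

occ-other : ∀ {c d} → d ≢ c → occ c [ d ] ≡ 0
occ-other {c} d≢c = cong length (filter-reject (_≟ c) d≢c)

rainbow-append-free : ∀ X c → X c ≡ false → ∀ cs →
                 suc (occ c cs) * rainbow X (cs ++ [ c ]) ≡ suc (suc (occ c cs)) * rainbow X cs
rainbow-append-free X c Xc cs = begin
  o₁ * rainbow X (cs ++ [ c ])
    ≡⟨ cong (o₁ *_) (rainbow-factor X c Xc (cs ++ [ c ])) ⟩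
  o₁ * (suc (occ c (cs ++ [ c ])) * rainbow (X ⊕ c) (cs ++ [ c ]))
    ≡⟨ cong₂ (λ o r → o₁ * (suc o * r)) occ-grows (rainbow-append-used (X ⊕ c) c (⊕-has X c) cs) ⟩
  o₁ * (o₂ * rainbow (X ⊕ c) cs)
    ≡⟨ x∙yz≈y∙xz o₁ o₂ (rainbow (X ⊕ c) cs) ⟩
  o₂ * (o₁ * rainbow (X ⊕ c) cs)
    ≡⟨ cong (o₂ *_) (rainbow-factor X c Xc cs) ⟨
  o₂ * rainbow X cs ∎
  where
    open ≡-Reasoning
    o₁ = suc (occ c cs)
    o₂ = suc o₁
    occ-grows : occ c (cs ++ [ c ]) ≡ o₁
    occ-grows = trans (occ-snoc c c cs) (trans (cong (occ c cs +_) (occ-self c)) (+-comm (occ c cs) 1))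
    ⊕-has : ∀ X c → (X ⊕ c) c ≡ true
    ⊕-has X c rewrite ≡ᵇ-refl c = ∨-zeroʳ (X c)

Rainbow : ∀ {n} → Palette → (Fin n → ℕ) → Subset n → Set
Rainbow X c S = (∀ i j → i ∈ S → j ∈ S → i ≢ j → c i ≢ c j)
              × (∀ i → i ∈ S → X (c i) ≡ false)

Rainbow-omit : ∀ {n} X (c : Fin (suc n) → ℕ) S →
               Rainbow X c (false ∷ S) ⇔ Rainbow X (c ∘ suc) S
Rainbow-omit X c S = mk⇔
  (λ (distinct , avoids) →
       (λ i j i∈S j∈S i≢j → distinct (suc i) (suc j) (there i∈S) (there j∈S) (i≢j ∘ Fin.suc-injective))
     , (λ i i∈S → avoids (suc i) (there i∈S)))
  (λ (distinct , avoids) →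
       (λ { (suc i) (suc j) (there i∈S) (there j∈S) i≢j → distinct i j i∈S j∈S (i≢j ∘ cong suc) })
     , (λ { (suc i) (there i∈S) → avoids i i∈S }))

Rainbow-take : ∀ {n} X (c : Fin (suc n) → ℕ) S →
               Rainbow X c (true ∷ S) ⇔ (X (c zero) ≡ false × Rainbow (X ⊕ c zero) (c ∘ suc) S)
Rainbow-take X c S = mk⇔
  (λ (distinct , avoids) →
       avoids zero here
     , (λ i j i∈S j∈S i≢j → distinct (suc i) (suc j) (there i∈S) (there j∈S) (i≢j ∘ Fin.suc-injective))
     , (λ i i∈S → cong₂ _∨_ (avoids (suc i) (there i∈S))
                            (≢⇒≡ᵇ-false (distinct (suc i) zero (there i∈S) here λ ()))))
  (λ (free , distinct , avoids) →
     let differs : ∀ j → j ∈ S → c (suc j) ≢ c zero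
         differs j j∈S = ≡ᵇ-false⇒≢ _ _ (∨-conicalʳ _ _ (avoids j j∈S))
     in (λ { zero    zero    _          _          i≢j → contradiction refl i≢j
           ; zero    (suc j) _          (there j∈S) _   → ≢-sym (differs j j∈S)
           ; (suc i) zero    (there i∈S) _          _   → differs i i∈S
           ; (suc i) (suc j) (there i∈S) (there j∈S) i≢j → distinct i j i∈S j∈S (i≢j ∘ cong suc) })
      , (λ { zero here → free
           ; (suc i) (there i∈S) → ∨-conicalˡ _ _ (avoids i i∈S) }))

rainbow? : ∀ {n} → Palette → (Fin n → ℕ) → Subset n → Bool
rainbow? X c []          = true
rainbow? X c (false ∷ S) = rainbow? X (c ∘ suc) S
rainbow? X c (true ∷ S)  = if X (c zero) then false else rainbow? (X ⊕ c zero) (c ∘ suc) S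

rainbow?-sound : ∀ {n} X (c : Fin n → ℕ) S → rainbow? X c S ≡ true → Rainbow X c S
rainbow?-sound X c []          _  = (λ _ _ ()) , (λ _ ())
rainbow?-sound X c (false ∷ S) ok = from (Rainbow-omit X c S) (rainbow?-sound X (c ∘ suc) S ok)
rainbow?-sound X c (true ∷ S)  ok with X (c zero) in free
... | false = from (Rainbow-take X c S) (free , rainbow?-sound (X ⊕ c zero) (c ∘ suc) S ok)

rainbow?-complete : ∀ {n} X (c : Fin n → ℕ) S → Rainbow X c S → rainbow? X c S ≡ true
rainbow?-complete X c []          _ = refl
rainbow?-complete X c (false ∷ S) r = rainbow?-complete X (c ∘ suc) S (to (Rainbow-omit X c S) r)
rainbow?-complete X c (true ∷ S)  r with to (Rainbow-take X c S) r
... | free , r′ rewrite free = rainbow?-complete (X ⊕ c zero) (c ∘ suc) S r′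

count : ∀ {A : Set} → (A → Bool) → List A → ℕ
count b []       = 0
count b (x ∷ xs) = if b x then suc (count b xs) else count b xs

count-++ : ∀ {A : Set} (b : A → Bool) xs ys → count b (xs ++ ys) ≡ count b xs + count b ys
count-++ b []       ys = refl
count-++ b (x ∷ xs) ys with b x
... | true  = cong suc (count-++ b xs ys)
... | false = count-++ b xs ys

count-map : ∀ {A B : Set} (b : B → Bool) (f : A → B) xs → count b (map f xs) ≡ count (b ∘ f) xs
count-map b f []       = refl
count-map b f (x ∷ xs) with b (f x)
... | true  = cong suc (count-map b f xs)
... | false = count-map b f xs

count-none : ∀ {A : Set} (xs : List A) → count (λ _ → false) xs ≡ 0
count-none []       = refl
count-none (x ∷ xs) = count-none xs

length-filter-count : ∀ {A : Set} {P : A → Set} (P? : Decidable P) (b : A → Bool) →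
                      (∀ x → P x → b x ≡ true) → (∀ x → b x ≡ true → P x) →
                      ∀ xs → length (filter P? xs) ≡ count b xs
length-filter-count P? b sound complete []       = refl
length-filter-count P? b sound complete (x ∷ xs) with P? x | b x in bx
... | yes px | true  = cong suc (length-filter-count P? b sound complete xs)
... | yes px | false with () ← trans (sym (sound x px)) bx
... | no ¬px | true  = contradiction (complete x bx) ¬px
... | no ¬px | false = length-filter-count P? b sound complete xs

count-rainbow? : ∀ n X (c : Fin n → ℕ) → count (rainbow? X c) (allSubsets n) ≡ rainbow X (tabulate c)
count-rainbow? zero    X c = refl
count-rainbow? (suc n) X c = begin
  count (rainbow? X c) (map (false ∷_) subsets ++ map (true ∷_) subsets)
    ≡⟨ count-++ (rainbow? X c) (map (false ∷_) subsets) _ ⟩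
  count (rainbow? X c) (map (false ∷_) subsets) + count (rainbow? X c) (map (true ∷_) subsets)
    ≡⟨ cong₂ _+_ (count-map (rainbow? X c) (false ∷_) subsets) (count-map (rainbow? X c) (true ∷_) subsets) ⟩
  count (rainbow? X (c ∘ suc)) subsets + count (λ S → rainbow? X c (true ∷ S)) subsets
    ≡⟨ cong (_+ count (λ S → rainbow? X c (true ∷ S)) subsets) (count-rainbow? n X (c ∘ suc)) ⟩
  rainbow X cs + count (λ S → rainbow? X c (true ∷ S)) subsets
    ≡⟨ take-first ⟩
  rainbow X (tabulate c) ∎
  where
    open ≡-Reasoning
    subsets = allSubsets n
    cs = tabulate (c ∘ suc)
    take-first : rainbow X cs + count (λ S → rainbow? X c (true ∷ S)) subsets ≡ rainbow X (c zero ∷ cs)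
    take-first with X (c zero)
    ... | true  = trans (cong (rainbow X cs +_) (count-none subsets)) (+-identityʳ _)
    ... | false = cong (rainbow X cs +_) (count-rainbow? n (X ⊕ c zero) (c ∘ suc))

-- A graph whose edges join exactly the distinct vertices of equal colour is a
-- disjoint union of cliques; its stable sets are its rainbow sets.
F-colour-classes : ∀ {n} (G : Graph n) (c : Fin n → ℕ) →
                   (∀ {i j} → Adj G i j → i ≢ j × c i ≡ c j) →
                   (∀ {i j} → i ≢ j → c i ≡ c j → Adj G i j) →
                   F G ≡ rainbow ∅ (tabulate c)
F-colour-classes {n} G c edge⇒ ⇒edge =
  trans (length-filter-count (stable? G) (rainbow? ∅ c)
           (λ S stable → rainbow?-complete ∅ c S
              ((λ i j i∈S j∈S i≢j ci≡cj → stable i j i∈S j∈S (⇒edge i≢j ci≡cj)) , (λ _ _ → refl)))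
           (λ S ok i j i∈S j∈S edge →
              let (i≢j , ci≡cj) = edge⇒ edge in proj₁ (rainbow?-sound ∅ c S ok) i j i∈S j∈S i≢j ci≡cj)
           (allSubsets n))
        (count-rainbow? n ∅ c)

-- Φ α q ρ = (q + 2)^ρ (q + 1)^(α − ρ): the number of stable sets of T_{ρ + qα, α}
-- (ρ colour classes of size q + 1 and α − ρ of size q), for 0 ≤ ρ ≤ α.
Φ : ℕ → ℕ → ℕ → ℕ
Φ α q ρ = suc (suc q) ^ ρ * suc q ^ (α ∸ ρ)

-- Enlarging one class from size q to q + 1 turns a factor q + 1 into q + 2.
Φ-step : ∀ α q ρ → ρ < α → suc (suc q) * Φ α q ρ ≡ suc q * Φ α q (suc ρ)
Φ-step α q ρ ρ<α = begin
  a * (A * b ^ (α ∸ ρ))   ≡⟨ cong (λ e → a * (A * b ^ e)) (+-∸-assoc 1 ρ<α) ⟩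
  a * (A * (b * B))       ≡⟨ cong (a *_) (x∙yz≈y∙xz A b B) ⟩
  a * (b * (A * B))       ≡⟨ x∙yz≈y∙xz a b (A * B) ⟩
  b * (a * (A * B))       ≡⟨ cong (b *_) (*-assoc a A B) ⟨
  b * (a * A * B)         ∎
  where
    open ≡-Reasoning
    a = suc (suc q)
    b = suc q
    A = a ^ ρ
    B = b ^ (α ∸ suc ρ)

-- The positions (q , α) and (q + 1 , 0) describe the same Turán graph.
Φ-wrap : ∀ α q → Φ α q α ≡ Φ α (suc q) 0
Φ-wrap α q = begin
  suc (suc q) ^ α * suc q ^ (α ∸ α) ≡⟨ cong (λ e → suc (suc q) ^ α * suc q ^ e) (n∸n≡0 α) ⟩
  suc (suc q) ^ α * 1               ≡⟨ *-identityʳ _ ⟩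
  suc (suc q) ^ α                   ≡⟨ *-identityˡ _ ⟨
  1 * suc (suc q) ^ α               ∎
  where open ≡-Reasoning

Φ-recurrence : ∀ α q ρ → ρ ≤ α → Φ (suc α) q (suc ρ) ≡ Φ (suc α) q ρ + Φ α q ρ
Φ-recurrence α q ρ ρ≤α = begin
  suc b * A * B           ≡⟨ solve 3 (λ b A B → (con 1 :+ b) :* A :* B := A :* (b :* B) :+ A :* B) refl b A B ⟩
  A * (b * B) + A * B     ≡⟨ cong (λ e → A * b ^ e + A * B) (+-∸-assoc 1 ρ≤α) ⟨
  A * b ^ (suc α ∸ ρ) + A * B ∎
  where
    open ≡-Reasoning
    open +-*-Solver using (solve; _:+_; _:*_; _:=_; con)
    b = suc q
    A = suc b ^ ρ
    B = b ^ (α ∸ ρ)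

module TuránColours (α : ℕ) .{{_ : NonZero α}} where

  colours : ℕ → List ℕ
  colours n = applyUpTo (_% α) n

  colours-suc : ∀ n → colours (suc n) ≡ colours n ++ [ n % α ]
  colours-suc n = sym (applyUpTo-∷ʳ (_% α) n)

  colour-of : ∀ q ρ → ρ < α → (ρ + q * α) % α ≡ ρ
  colour-of q ρ ρ<α = trans ([m+kn]%n≡m%n ρ q α) (m<n⇒m%n≡m ρ<α)

  -- Induction along the positions n = ρ + q * α with 0 ≤ ρ ≤ α: advance ρ by
  -- one, and pass from the full block (q , α) to the same position (q + 1 , 0).
  block-induction : (P : ℕ → ℕ → Set) → P 0 0 →
                    (∀ q ρ → ρ < α → P q ρ → P q (suc ρ)) →
                    (∀ q → P q α → P (suc q) 0) →
                    ∀ q ρ → ρ ≤ α → P q ρ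
  block-induction P base step wrap zero    zero    _   = base
  block-induction P base step wrap (suc q) zero    _   = wrap q (block-induction P base step wrap q α ≤-refl)
  block-induction P base step wrap q       (suc ρ) ρ<α =
    step q ρ ρ<α (block-induction P base step wrap q ρ (<⇒≤ ρ<α))

  Counts : ℕ → ℕ → Set
  Counts q ρ = ∀ c → (c < ρ → occ c (colours (ρ + q * α)) ≡ suc q)
                   × (ρ ≤ c → c < α → occ c (colours (ρ + q * α)) ≡ q)

  counts : ∀ q ρ → ρ ≤ α → Counts q ρ
  counts = block-induction Counts (λ c → (λ ()) , (λ _ _ → refl)) step wrap
    where
      occ-next : ∀ c q ρ → ρ < α → occ c (colours (suc ρ + q * α)) ≡ occ c (colours (ρ + q * α)) + occ c [ ρ ]
      occ-next c q ρ ρ<α = begin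
        occ c (colours (suc n))             ≡⟨ cong (occ c) (colours-suc n) ⟩
        occ c (colours n ++ [ n % α ])      ≡⟨ occ-snoc c (n % α) (colours n) ⟩
        occ c (colours n) + occ c [ n % α ] ≡⟨ cong (λ d → occ c (colours n) + occ c [ d ]) (colour-of q ρ ρ<α) ⟩
        occ c (colours n) + occ c [ ρ ]     ∎
        where
          open ≡-Reasoning
          n = ρ + q * α

      step : ∀ q ρ → ρ < α → Counts q ρ → Counts q (suc ρ)
      step q ρ ρ<α IH c = below , above
        where
          below : c < suc ρ → occ c (colours (suc ρ + q * α)) ≡ suc q
          below c<1+ρ with m<1+n⇒m<n∨m≡n c<1+ρ
          ... | inj₁ c<ρ  = trans (occ-next c q ρ ρ<α)
                                  (trans (cong₂ _+_ (proj₁ (IH c) c<ρ) (occ-other (>⇒≢ c<ρ))) (+-identityʳ _))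
          ... | inj₂ refl = trans (occ-next c q ρ ρ<α)
                                  (trans (cong₂ _+_ (proj₂ (IH c) ≤-refl ρ<α) (occ-self c)) (+-comm q 1))
          above : suc ρ ≤ c → c < α → occ c (colours (suc ρ + q * α)) ≡ q
          above ρ<c c<α = trans (occ-next c q ρ ρ<α)
                                (trans (cong₂ _+_ (proj₂ (IH c) (<⇒≤ ρ<c) c<α) (occ-other (<⇒≢ ρ<c))) (+-identityʳ q))

      wrap : ∀ q → Counts q α → Counts (suc q) 0
      wrap q IH c = (λ ()) , λ _ c<α → proj₁ (IH c) c<α

  rainbow-colours : ∀ q ρ → ρ ≤ α → rainbow ∅ (colours (ρ + q * α)) ≡ Φ α q ρ
  rainbow-colours = block-induction (λ q ρ → rainbow ∅ (colours (ρ + q * α)) ≡ Φ α q ρ)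
                      (sym (trans (*-identityˡ _) (^-zeroˡ α))) step (λ q IH → trans IH (Φ-wrap α q))
    where
      step : ∀ q ρ → ρ < α → rainbow ∅ (colours (ρ + q * α)) ≡ Φ α q ρ →
             rainbow ∅ (colours (suc ρ + q * α)) ≡ Φ α q (suc ρ)
      step q ρ ρ<α IH = *-cancelˡ-≡ _ _ (suc q) (begin
        suc q * rainbow ∅ (colours (suc ρ + q * α))
          ≡⟨ cong (λ cs → suc q * rainbow ∅ cs) (trans (colours-suc n) (cong (λ d → colours n ++ [ d ]) (colour-of q ρ ρ<α))) ⟩
        suc q * rainbow ∅ (colours n ++ [ ρ ])
          ≡⟨ cong (λ o → suc o * rainbow ∅ (colours n ++ [ ρ ])) occ-ρ ⟨
        suc (occ ρ (colours n)) * rainbow ∅ (colours n ++ [ ρ ])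
          ≡⟨ rainbow-append-free ∅ ρ refl (colours n) ⟩
        suc (suc (occ ρ (colours n))) * rainbow ∅ (colours n)
          ≡⟨ cong₂ (λ o r → suc (suc o) * r) occ-ρ IH ⟩
        suc (suc q) * Φ α q ρ
          ≡⟨ Φ-step α q ρ ρ<α ⟩
        suc q * Φ α q (suc ρ) ∎)
        where
          open ≡-Reasoning
          n = ρ + q * α
          occ-ρ : occ ρ (colours n) ≡ q
          occ-ρ = proj₂ (counts q ρ (<⇒≤ ρ<α) ρ) ≤-refl ρ<α

-- The colouring of T_{n,α}, listed vertex by vertex, is TuránColours.colours α n.
tabulate-toℕ : ∀ {A : Set} n (f : ℕ → A) → tabulate (f ∘ toℕ {n}) ≡ applyUpTo f n
tabulate-toℕ zero    f = refl
tabulate-toℕ (suc n) f = cong (f 0 ∷_) (tabulate-toℕ n (f ∘ suc))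

fT-closed : ∀ k q ρ → ρ ≤ suc k → fT (ρ + q * suc k) (suc k) ≡ Φ (suc k) q ρ
fT-closed k q ρ ρ≤α = begin
  F (Turán n k)                                      ≡⟨ F-colour-classes (Turán n k) (λ i → toℕ i % suc k) id _,_ ⟩
  rainbow ∅ (tabulate {n = n} (λ i → toℕ i % suc k)) ≡⟨ cong (rainbow ∅) (tabulate-toℕ n (_% suc k)) ⟩
  rainbow ∅ (TuránColours.colours (suc k) n)         ≡⟨ TuránColours.rainbow-colours (suc k) q ρ ρ≤α ⟩
  Φ (suc k) q ρ                                      ∎
  where
    open ≡-Reasoning
    n = ρ + q * suc k

-- The two boundary cases: one clique K_n, and α = n isolated vertices.
fT-one-class : ∀ n → fT n 1 ≡ n + 1
fT-one-class n = begin
  fT n 1           ≡⟨ cong (λ m → fT m 1) (*-identityʳ n) ⟨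
  fT (0 + n * 1) 1 ≡⟨ fT-closed 0 n 0 z≤n ⟩
  1 * (suc n * 1)  ≡⟨ trans (*-identityˡ _) (*-identityʳ _) ⟩
  suc n            ≡⟨ +-comm 1 n ⟩
  n + 1            ∎
  where open ≡-Reasoning

fT-singletons : ∀ k → fT (suc k) (suc k) ≡ 2 ^ suc k
fT-singletons k = begin
  fT α α                  ≡⟨ cong (λ m → fT m α) (+-identityʳ α) ⟨
  fT (α + 0 * α) α        ≡⟨ fT-closed k 0 α ≤-refl ⟩
  2 ^ α * 1 ^ (α ∸ α)     ≡⟨ cong (2 ^ α *_) (^-zeroˡ (α ∸ α)) ⟩
  2 ^ α * 1               ≡⟨ *-identityʳ _ ⟩
  2 ^ α                   ∎
  where
    open ≡-Reasoning
    α = suc k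

ceilDiv-block : ∀ k q ρ → ρ ≤ k → ceilDiv (suc ρ + q * suc k) (suc k) ≡ suc q
ceilDiv-block k q ρ ρ≤k = begin
  (suc ρ + q * suc k + k) / suc k    ≡⟨ cong (_/ suc k) (solve 3 (λ ρ q k →
                                           con 1 :+ ρ :+ q :* (con 1 :+ k) :+ k := ρ :+ (con 1 :+ q) :* (con 1 :+ k)) refl ρ q k) ⟩
  (ρ + suc q * suc k) / suc k        ≡⟨ +-distrib-/-∣ʳ ρ (n∣m*n (suc q)) ⟩
  ρ / suc k + suc q * suc k / suc k  ≡⟨ cong₂ _+_ (m<n⇒m/n≡0 (s≤s ρ≤k)) (m*n/n≡m (suc q) (suc k)) ⟩
  suc q                              ∎
  where
    open ≡-Reasoning
    open +-*-Solver using (solve; _:+_; _:*_; _:=_; con)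

minus-ceilDiv-block : ∀ k q ρ → ρ ≤ k →
                      suc ρ + q * suc k ∸ ceilDiv (suc ρ + q * suc k) (suc k) ≡ ρ + q * k
minus-ceilDiv-block k q ρ ρ≤k = begin
  suc ρ + q * suc k ∸ ceilDiv (suc ρ + q * suc k) (suc k) ≡⟨ cong (suc ρ + q * suc k ∸_) (ceilDiv-block k q ρ ρ≤k) ⟩
  suc ρ + q * suc k ∸ suc q                              ≡⟨ cong (_∸ suc q) (solve 3 (λ ρ q k →
                                                              con 1 :+ ρ :+ q :* (con 1 :+ k) := (con 1 :+ q) :+ (ρ :+ q :* k)) refl ρ q k) ⟩
  suc q + (ρ + q * k) ∸ suc q                            ≡⟨ m+n∸m≡n (suc q) _ ⟩
  ρ + q * k                                              ∎
  where
    open ≡-Reasoning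
    open +-*-Solver using (solve; _:+_; _:*_; _:=_; con)

fT-recurrence-block : ∀ k q ρ → ρ ≤ suc k →
  fT (suc ρ + q * suc (suc k)) (suc (suc k))
    ≡ fT (ρ + q * suc (suc k)) (suc (suc k))
      + fT (suc ρ + q * suc (suc k) ∸ ceilDiv (suc ρ + q * suc (suc k)) (suc (suc k))) (suc k)
fT-recurrence-block k q ρ ρ≤k+1 = begin
  fT (suc ρ + q * α) α                         ≡⟨ fT-closed (suc k) q (suc ρ) (s≤s ρ≤k+1) ⟩
  Φ α q (suc ρ)                                ≡⟨ Φ-recurrence (suc k) q ρ ρ≤k+1 ⟩
  Φ α q ρ + Φ (suc k) q ρ                      ≡⟨ cong₂ _+_ (fT-closed (suc k) q ρ (m≤n⇒m≤1+n ρ≤k+1)) (fT-closed k q ρ ρ≤k+1) ⟨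
  fT (ρ + q * α) α + fT (ρ + q * suc k) (suc k) ≡⟨ cong (λ m → fT (ρ + q * α) α + fT m (suc k)) (minus-ceilDiv-block (suc k) q ρ ρ≤k+1) ⟨
  fT (ρ + q * α) α + fT (suc ρ + q * α ∸ ceilDiv (suc ρ + q * α) α) (suc k) ∎
  where
    open ≡-Reasoning
    α = suc (suc k)

-- Every n ≥ 1 is such a position: n − 1 = ρ + qα with ρ = (n − 1) mod α.
fT-recurrence : ∀ k n → 1 ≤ n →
  fT n (suc (suc k)) ≡ fT (n ∸ 1) (suc (suc k)) + fT (n ∸ ceilDiv n (suc (suc k))) (suc k)
fT-recurrence k (suc m) _ =
  subst (λ x → fT (suc x) α ≡ fT x α + fT (suc x ∸ ceilDiv (suc x) α) (suc k))
        (sym (m≡m%n+[m/n]*n m α))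
        (fT-recurrence-block k (m / α) (m % α) (m<1+n⇒m≤n (m%n<n m α)))
  where α = suc (suc k)

lemma10 : ∀ (n α : ℕ) → 1 ≤ α → α ≤ n →
    (α ≡ 1 → fT n α ≡ n + 1)
    × (α ≡ n → fT n α ≡ 2 ^ n)
    × (2 ≤ α → α ≤ n ∸ 1 → fT n α ≡ fT (n ∸ 1) α + fT (n ∸ ceilDiv n α) (α ∸ 1))
lemma10 n (suc k) _ α≤n = one-class , singletons , recurrence
  where
    one-class : suc k ≡ 1 → fT n (suc k) ≡ n + 1
    one-class refl = fT-one-class n

    singletons : suc k ≡ n → fT n (suc k) ≡ 2 ^ n
    singletons α≡n = subst (λ m → fT m (suc k) ≡ 2 ^ m) α≡n (fT-singletons k)

    recurrence : 2 ≤ suc k → suc k ≤ n ∸ 1 →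
                 fT n (suc k) ≡ fT (n ∸ 1) (suc k) + fT (n ∸ ceilDiv n (suc k)) k
    recurrence (s≤s (s≤s {n = k′} z≤n)) _ = fT-recurrence k′ n (≤-trans (s≤s z≤n) α≤n)
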